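{- Let $k\ge 2$ and let $n$ be a positive multiple of $k$. Let $v_1,\ldots,v_{2n}$ be points in convex position labeled in clockwise order, partitioned into the $2n/k$ blocks $B_i=\{v_{(i-1)k+1},\ldots,v_{ik}\}$, and colored with colors $c_1,\ldots,c_k$ so that $v_{(i-1)k+r}$ ($1\le r\le k$) gets color $c_r$ if $i$ is odd and $c_{k+1-r}$ if $i$ is even. A plane perfect matching $M$ on $v_1,\ldots,v_{2n}$ is a $k$-colored matching if and only if $M$ has a valid block structure and $M$ contains no edge $v_sv_e$ ($s<e$) with the following four properties: (i) $v_s$ and $v_e$ lie in different blocks, say $v_s\in S$ and $v_e\in E$; (ii) there is no edge of $M$ joining two vertices of different colors with both endpoints among $v_{s+1},\ldots,v_{e-1}$; (iii) the number of blocks strictly between $S$ and $E$ is odd; (iv) if $v_s$ is the $j$-th vertex of $S$ (in increasing index order), then $v_e$ is the $(j+1)$-st vertex of $E$.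
   Context: A plane perfect matching on points in convex position is a set of pairwise non-crossing straight-line segments between the points such that each point is an endpoint of exactly one segment. Each edge $v_av_b$ with $a<b$ is regarded as directed from $v_a$ to $v_b$; $v_a$ has outdegree $1$ and $v_b$ has outdegree $0$. The matching has a valid block structure if within every block, no vertex of outdegree $1$ has smaller index than a vertex of outdegree $0$ (i.e. the outdegrees within each block read $0,\ldots,0,1,\ldots,1$ in index order). A $k$-colored matching is a plane perfect matching in which every edge joins two vertices of the same color. -}

module Defs where

open import Data.Nat using (ℕ; zero; suc; _<_; _∸_; _≡ᵇ_; NonZero)
open import Data.Nat.DivMod using (_/_; _%_)
open import Data.Fin using (Fin; toℕ)
open import Data.Bool using (if_then_else_)
open import Data.Product using (_×_; ∃)
open import Relation.Binary.PropositionalEquality using (_≡_; _≢_)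
open import Relation.Nullary using (¬_)

-- Vertices v_1, ..., v_N are represented 0-indexed by Fin N
-- (index p stands for v_(p+1)); points are in convex position in
-- clockwise order, so crossing of segments is purely combinatorial.

record PerfectMatching (N : ℕ) : Set where
  field
    mate       : Fin N → Fin N
    involutive : ∀ i → mate (mate i) ≡ i
    noFixed    : ∀ i → mate i ≢ i
open PerfectMatching public

-- Two segments v_a v_(mate a) and v_b v_(mate b) between points in convex
-- position cross iff their endpoints interleave: a < b < mate a < mate b.
IsPlane : ∀ {N} → PerfectMatching N → Set
IsPlane M = ∀ a b → ¬ (toℕ a < toℕ b × toℕ b < toℕ (mate M a)
                       × toℕ (mate M a) < toℕ (mate M b))

-- outdegree 1 / outdegree 0 (edge directed from smaller to larger index)
Out1 : ∀ {N} → PerfectMatching N → Fin N → Set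
Out1 M a = toℕ a < toℕ (mate M a)

Out0 : ∀ {N} → PerfectMatching N → Fin N → Set
Out0 M a = toℕ (mate M a) < toℕ a

module _ (k : ℕ) .{{_ : NonZero k}} where
  -- 0-indexed block of a 0-indexed vertex (block B_(i+1) = indices ik..ik+k-1)
  block : ℕ → ℕ
  block p = p / k

  -- 0-indexed position of a vertex within its block (r - 1)
  pos : ℕ → ℕ
  pos p = p % k

  -- 0-indexed color: c_(r) for odd (1-indexed) blocks, c_(k+1-r) for even ones
  color : ℕ → ℕ
  color p = if (block p % 2) ≡ᵇ 0 then pos p else k ∸ 1 ∸ pos p

  module _ {N : ℕ} (M : PerfectMatching N) where
    KColored : Set
    KColored = ∀ a → color (toℕ a) ≡ color (toℕ (mate M a))

    ValidBlockStructure : Set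
    ValidBlockStructure = ∀ a b → block (toℕ a) ≡ block (toℕ b) →
      toℕ a < toℕ b → ¬ (Out1 M a × Out0 M b)

    Forbidden : Fin N → Set
    Forbidden s =
      toℕ s < toℕ (mate M s)
      × block (toℕ s) ≢ block (toℕ (mate M s))
      × ¬ (∃ λ x → toℕ s < toℕ x × toℕ x < toℕ (mate M s)
                  × toℕ s < toℕ (mate M x) × toℕ (mate M x) < toℕ (mate M s)
                  × color (toℕ x) ≢ color (toℕ (mate M x)))
      × (block (toℕ (mate M s)) ∸ block (toℕ s) ∸ 1) % 2 ≡ 1
      × pos (toℕ (mate M s)) ≡ suc (pos (toℕ s))

module Submission where

-- With 0-indexed vertices, the color of x depends only on x mod 2k, and two residues share a
-- color exactly when they are equal or mirrored, x + y + 1 ≡ 0 (mod 2k).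
-- (⇐) Every edge {s, e}, s < e, is mirrored, by induction on the nesting: the vertices strictly
-- between s and e are covered by consecutive mirrored edges {p, q}, each taking the next
-- uncovered vertex p to q + 1 ≡ −p, so e ≡ ±(s + 1). If e ≡ −(s + 1) the edge is mirrored; if
-- e ≡ s + 1, then either v_s ends its block (and the edge is again mirrored), or e = s + 1 breaks
-- the block structure, or {s, e} has properties (i)–(iv).
-- (⇒) Equal color and equal block parity force equal position, so no edge stays inside a block,
-- which with planarity gives the block structure; and (iii) gives the endpoints of a forbidden
-- edge equal block parity, so (iv) contradicts equal color.

open import Defs
open import Data.Nat using (ℕ; _≤_; _<_; _*_; NonZero)
open import Data.Nat.Divisibility using (_∣_)
open import Data.Product using (_×_; ∃)
open import Relation.Nullary using (¬_)
open import Function.Bundles using (_⇔_; mk⇔)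
open import Data.Nat using (zero; suc; pred; _+_; _∸_; _≡ᵇ_; z≤n; s≤s; _≤?_)
open import Data.Nat.Properties
open import Data.Nat.DivMod
open import Data.Nat.Divisibility
  using (divides; _∣?_; ∣-trans; n∣m*n; ∣m∣n⇒∣m+n; ∣m+n∣m⇒∣n; *-monoʳ-∣; *-cancelʳ-∣)
open import Data.Nat.Induction using (<-wellFounded)
open import Data.Nat.Tactic.RingSolver using (solve-∀)
open import Data.Product using (_,_; proj₁; proj₂)
open import Data.Sum using (_⊎_; inj₁; inj₂)
open import Data.Empty using (⊥; ⊥-elim)
open import Data.Bool using (if_then_else_)
open import Data.Fin using (Fin; toℕ; fromℕ<)
open import Function using (_∘_)
open import Data.Fin.Properties using (toℕ-injective; toℕ<n; toℕ-fromℕ<)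
open import Induction.WellFounded using (Acc; acc)
open import Relation.Nullary using (yes; no; contradiction)
open import Relation.Binary.Definitions using (tri<; tri≈; tri>)
open import Relation.Binary.PropositionalEquality

[r+q*d]%d≡r : ∀ {d} .{{_ : NonZero d}} {r} q → r < d → (r + q * d) % d ≡ r
[r+q*d]%d≡r {d} {r} q r<d = trans ([m+kn]%n≡m%n r q d) (m<n⇒m%n≡m r<d)

[r+q*d]/d≡q : ∀ {d} .{{_ : NonZero d}} {r} q → r < d → (r + q * d) / d ≡ q
[r+q*d]/d≡q {d} {r} q r<d =
  trans (+-distrib-/-∣ʳ r (n∣m*n q)) (cong₂ _+_ (m<n⇒m/n≡0 r<d) (m*n/n≡m q d))

m%2≡0⊎m%2≡1 : ∀ m → m % 2 ≡ 0 ⊎ m % 2 ≡ 1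
m%2≡0⊎m%2≡1 m with m % 2 | m%n<n m 2
... | 0           | _             = inj₁ refl
... | 1           | _             = inj₂ refl
... | suc (suc _) | s≤s (s≤s ())

odd-gap : ∀ m n → (m + suc n * 2 ∸ m ∸ 1) % 2 ≡ 1
odd-gap m n = trans (cong (λ z → (z ∸ 1) % 2) (m+n∸m≡n m (suc n * 2))) ([r+q*d]%d≡r n (n<1+n 1))

odd-gap⇒same-parity : ∀ m n → (n ∸ m ∸ 1) % 2 ≡ 1 → n % 2 ≡ m % 2
odd-gap⇒same-parity m n odd with n ∸ m in gap
... | suc d = begin
  n % 2             ≡⟨ cong (_% 2) (trans (sym (m+[n∸m]≡n m≤n)) (cong (m +_) gap)) ⟩
  (m + suc d) % 2   ≡⟨ %-remove-+ʳ m (divides (suc (d / 2)) (cong suc d≡)) ⟩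
  m % 2             ∎
  where
  open ≡-Reasoning
  m≤n : m ≤ n
  m≤n = <⇒≤ (m∸n≢0⇒n<m (λ n∸m≡0 → 0≢1+n (trans (sym n∸m≡0) gap)))
  d≡ : d ≡ 1 + d / 2 * 2
  d≡ = trans (m≡m%n+[m/n]*n d 2) (cong (_+ d / 2 * 2) odd)

suc[m+n]≡suc[m%d+n%d]+[m/d+n/d]*d : ∀ m n d .{{_ : NonZero d}} →
  suc (m + n) ≡ suc (m % d + n % d) + (m / d + n / d) * d
suc[m+n]≡suc[m%d+n%d]+[m/d+n/d]*d m n d = begin
  suc (m + n)
    ≡⟨ cong₂ (λ x y → suc (x + y)) (m≡m%n+[m/n]*n m d) (m≡m%n+[m/n]*n n d) ⟩
  suc ((m % d + m / d * d) + (n % d + n / d * d))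
    ≡⟨ interchange (m % d) (m / d) (n % d) (n / d) d ⟩
  suc (m % d + n % d) + (m / d + n / d) * d ∎
  where
  open ≡-Reasoning
  interchange : ∀ r q s p d → suc ((r + q * d) + (s + p * d)) ≡ suc (r + s) + (q + p) * d
  interchange = solve-∀

-- The only multiple of d in the range (0, 2d) is d itself.
∣suc[m+n]⇒suc[m%d+n%d]≡d : ∀ m n {d} .{{_ : NonZero d}} →
  d ∣ suc (m + n) → suc (m % d + n % d) ≡ d
∣suc[m+n]⇒suc[m%d+n%d]≡d m n {d} d∣ = multiple-below-2d d∣remainders
  where
  d∣remainders : d ∣ suc (m % d + n % d)
  d∣remainders = ∣m+n∣m⇒∣n
    (subst (d ∣_) (trans (suc[m+n]≡suc[m%d+n%d]+[m/d+n/d]*d m n d)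
                         (+-comm (suc (m % d + n % d)) ((m / d + n / d) * d))) d∣)
    (n∣m*n (m / d + n / d))
  below-2d : suc (m % d + n % d) < d + d
  below-2d = subst (_≤ d + d) (cong suc (+-suc (m % d) (n % d)))
                   (+-mono-≤ (m%n<n m d) (m%n<n n d))
  multiple-below-2d : d ∣ suc (m % d + n % d) → suc (m % d + n % d) ≡ d
  multiple-below-2d (divides 1 eq) = trans eq (+-identityʳ d)
  multiple-below-2d (divides (suc (suc j)) eq) =
    contradiction (subst (_< d + d) eq below-2d) (≤⇒≯ (+-monoʳ-≤ d (m≤m+n d (j * d))))

module Coloring (k : ℕ) .{{_ : NonZero k}} where
  open ≡-Reasoning

  pos<k : ∀ x → pos k x < k
  pos<k x = m%n<n x k

  x≡pos+block*k : ∀ x → x ≡ pos k x + block k x * k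
  x≡pos+block*k x = m≡m%n+[m/n]*n x k

  pos-block-injective : ∀ x y → pos k x ≡ pos k y → block k x ≡ block k y → x ≡ y
  pos-block-injective x y p≡ b≡ = begin
    x                       ≡⟨ x≡pos+block*k x ⟩
    pos k x + block k x * k ≡⟨ cong₂ (λ r q → r + q * k) p≡ b≡ ⟩
    pos k y + block k y * k ≡⟨ x≡pos+block*k y ⟨
    y                       ∎

  block-between : ∀ {x y z} → x ≤ y → y ≤ z → block k x ≡ block k z → block k y ≡ block k x
  block-between x≤y y≤z x≡z =
    ≤-antisym (subst (block k _ ≤_) (sym x≡z) (/-monoˡ-≤ k y≤z)) (/-monoˡ-≤ k x≤y)

  color-even : ∀ x → block k x % 2 ≡ 0 → color k x ≡ pos k x
  color-even x = cong (λ b → if b ≡ᵇ 0 then pos k x else k ∸ 1 ∸ pos k x)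

  color-odd : ∀ x → block k x % 2 ≡ 1 → color k x ≡ k ∸ 1 ∸ pos k x
  color-odd x = cong (λ b → if b ≡ᵇ 0 then pos k x else k ∸ 1 ∸ pos k x)

  color-injective-on-parity : ∀ x y → block k x % 2 ≡ block k y % 2 →
    color k x ≡ color k y → pos k x ≡ pos k y
  color-injective-on-parity x y parity≡ color≡ with m%2≡0⊎m%2≡1 (block k x)
  ... | inj₁ even = begin
    pos k x   ≡⟨ color-even x even ⟨
    color k x ≡⟨ color≡ ⟩
    color k y ≡⟨ color-even y (trans (sym parity≡) even) ⟩
    pos k y   ∎
  ... | inj₂ odd = suc-injective (∸-cancelˡ-≡ (pos<k x) (pos<k y) (begin
    k ∸ suc (pos k x)   ≡⟨ ∸-+-assoc k 1 (pos k x) ⟨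
    k ∸ 1 ∸ pos k x     ≡⟨ color-odd x odd ⟨
    color k x           ≡⟨ color≡ ⟩
    color k y           ≡⟨ color-odd y (trans (sym parity≡) odd) ⟩
    k ∸ 1 ∸ pos k y     ≡⟨ ∸-+-assoc k 1 (pos k y) ⟩
    k ∸ suc (pos k y)   ∎))

  Mirror : ℕ → ℕ → Set
  Mirror x y = 2 * k ∣ suc (x + y)

  -- Mirrored vertices have complementary positions and block indices of opposite parity.
  mirror⇒color≡ : ∀ {x y} → Mirror x y → color k x ≡ color k y
  mirror⇒color≡ {x} {y} 2k∣ = by-parity (m%2≡0⊎m%2≡1 (block k x))
    where
    suc-positions : suc (pos k x + pos k y) ≡ k
    suc-positions = ∣suc[m+n]⇒suc[m%d+n%d]≡d x y (∣-trans (n∣m*n 2) 2k∣)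

    positions : pos k x + pos k y ≡ k ∸ 1
    positions = cong (_∸ 1) suc-positions

    2∣suc-blocks : 2 ∣ suc (block k x + block k y)
    2∣suc-blocks = *-cancelʳ-∣ k (subst (2 * k ∣_)
      (trans (suc[m+n]≡suc[m%d+n%d]+[m/d+n/d]*d x y k)
             (cong (_+ (block k x + block k y) * k) suc-positions)) 2k∣)

    parities : block k x % 2 + block k y % 2 ≡ 1
    parities = cong (_∸ 1) (∣suc[m+n]⇒suc[m%d+n%d]≡d (block k x) (block k y) 2∣suc-blocks)

    by-parity : block k x % 2 ≡ 0 ⊎ block k x % 2 ≡ 1 → color k x ≡ color k y
    by-parity (inj₁ even) = begin
      color k x                   ≡⟨ color-even x even ⟩
      pos k x                     ≡⟨ m+n∸n≡m (pos k x) (pos k y) ⟨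
      pos k x + pos k y ∸ pos k y ≡⟨ cong (_∸ pos k y) positions ⟩
      k ∸ 1 ∸ pos k y             ≡⟨ color-odd y (trans (cong (_+ block k y % 2) (sym even)) parities) ⟨
      color k y                   ∎
    by-parity (inj₂ odd) = begin
      color k x                   ≡⟨ color-odd x odd ⟩
      k ∸ 1 ∸ pos k x             ≡⟨ cong (_∸ pos k x) positions ⟨
      pos k x + pos k y ∸ pos k x ≡⟨ m+n∸m≡n (pos k x) (pos k y) ⟩
      pos k y                     ≡⟨ color-even y (cong pred (trans (cong (_+ block k y % 2) (sym odd)) parities)) ⟨
      color k y                   ∎

  suc-pos<k : ∀ x → ¬ k ∣ suc x → suc (pos k x) < k
  suc-pos<k x k∤ with m≤n⇒m<n∨m≡n (pos<k x)
  ... | inj₁ lt = lt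
  ... | inj₂ eq = contradiction
    (divides (suc (block k x)) (trans (cong suc (x≡pos+block*k x)) (cong (_+ block k x * k) eq))) k∤

  shifted-pos-block : ∀ x m → ¬ k ∣ suc x →
    pos k (suc x + m * (2 * k)) ≡ suc (pos k x) × block k (suc x + m * (2 * k)) ≡ block k x + m * 2
  shifted-pos-block x m k∤ =
    trans (cong (_% k) shifted) ([r+q*d]%d≡r (block k x + m * 2) (suc-pos<k x k∤)) ,
    trans (cong (_/ k) shifted) ([r+q*d]/d≡q (block k x + m * 2) (suc-pos<k x k∤))
    where
    regroup : ∀ r q m k → suc (r + q * k) + m * (2 * k) ≡ suc r + (q + m * 2) * k
    regroup = solve-∀
    shifted : suc x + m * (2 * k) ≡ suc (pos k x) + (block k x + m * 2) * k
    shifted = trans (cong (λ z → suc z + m * (2 * k)) (x≡pos+block*k x))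
                    (regroup (pos k x) (block k x) m k)

  block-end-mirror : ∀ x m → k ∣ suc x → Mirror x (suc x + m * (2 * k))
  block-end-mirror x m k∣ =
    subst (2 * k ∣_) (sym (regroup x m k)) (∣m∣n⇒∣m+n (*-monoʳ-∣ 2 k∣) (n∣m*n m))
    where
    regroup : ∀ x m k → suc (x + (suc x + m * (2 * k))) ≡ 2 * suc x + m * (2 * k)
    regroup = solve-∀

  SignedCongruent : ℕ → ℕ → Set
  SignedCongruent a b = (∃ λ m → b ≡ a + m * (2 * k)) ⊎ 2 * k ∣ a + b

  signed-congruent-refl : ∀ a → SignedCongruent a a
  signed-congruent-refl a = inj₁ (0 , sym (+-identityʳ a))

  mirror-signed-congruent : ∀ {a q b} → a ≤ b → Mirror a q → SignedCongruent (suc q) b →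
    SignedCongruent a b
  mirror-signed-congruent {a} {q} {b} a≤b 2k∣ (inj₁ (m , b≡)) =
    inj₂ (subst (2 * k ∣_) (sym a+b≡) (∣m∣n⇒∣m+n 2k∣ (n∣m*n m)))
    where
    regroup : ∀ a q n → a + (suc q + n) ≡ suc (a + q) + n
    regroup = solve-∀
    a+b≡ : a + b ≡ suc (a + q) + m * (2 * k)
    a+b≡ = trans (cong (a +_) b≡) (regroup a q (m * (2 * k)))
  mirror-signed-congruent {a} {q} {b} a≤b 2k∣ (inj₂ 2k∣′) =
    congruent (∣m+n∣m⇒∣n (subst (2 * k ∣_) q+b≡ 2k∣′) 2k∣)
    where
    regroup : ∀ a q w → suc q + (a + w) ≡ suc (a + q) + w
    regroup = solve-∀
    q+b≡ : suc q + b ≡ suc (a + q) + (b ∸ a)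
    q+b≡ = trans (cong (suc q +_) (sym (m+[n∸m]≡n a≤b))) (regroup a q (b ∸ a))
    congruent : 2 * k ∣ b ∸ a → SignedCongruent a b
    congruent (divides m b∸a≡) = inj₁ (m , trans (sym (m+[n∸m]≡n a≤b)) (cong (a +_) b∸a≡))

shorter-subinterval : ∀ {a b c d} → a < c → c ≤ b → d ≤ b → d ∸ c < b ∸ a
shorter-subinterval {a} {b} {c} {d} a<c c≤b d≤b = ≤-<-trans (∸-monoˡ-≤ c d≤b) (∸-monoʳ-< a<c c≤b)

module PlaneMatching {N : ℕ} (M : PerfectMatching N) (plane : IsPlane M) where

  toℕ-mate-mate : ∀ x → toℕ (mate M (mate M x)) ≡ toℕ x
  toℕ-mate-mate x = cong toℕ (involutive M x)

  toℕ-mate≢ : ∀ x → toℕ (mate M x) ≢ toℕ x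
  toℕ-mate≢ x eq = noFixed M x (toℕ-injective eq)

  toℕ-mate-swap : ∀ {x y} → toℕ (mate M x) ≡ toℕ y → toℕ (mate M y) ≡ toℕ x
  toℕ-mate-swap {x} eq = cong toℕ (trans (cong (mate M) (sym (toℕ-injective eq))) (involutive M x))

  toℕ-mate-injective : ∀ {x y} → toℕ (mate M x) ≡ toℕ (mate M y) → toℕ x ≡ toℕ y
  toℕ-mate-injective {y = y} eq = sym (trans (sym (toℕ-mate-mate y)) (toℕ-mate-swap eq))

  no-crossing-from-left : ∀ a x → toℕ (mate M x) < toℕ a → toℕ a < toℕ x →
    toℕ x < toℕ (mate M a) → ⊥
  no-crossing-from-left a x x′<a a<x x<a′ with plane (mate M x) a
  ... | uncrossed rewrite involutive M x = uncrossed (x′<a , a<x , x<a′)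

  mate-inside : ∀ a x → toℕ a < toℕ x → toℕ x < toℕ (mate M a) →
    toℕ a < toℕ (mate M x) × toℕ (mate M x) < toℕ (mate M a)
  mate-inside a x a<x x<a′ =
    ≤∧≢⇒< (≮⇒≥ (λ x′<a → no-crossing-from-left a x x′<a a<x x<a′)) a≢x′ ,
    ≤∧≢⇒< (≮⇒≥ (λ a′<x′ → plane a x (a<x , x<a′ , a′<x′))) x′≢a′
    where
    a≢x′ : toℕ a ≢ toℕ (mate M x)
    a≢x′ a≡x′ = <⇒≢ x<a′ (sym (toℕ-mate-swap (sym a≡x′)))
    x′≢a′ : toℕ (mate M x) ≢ toℕ (mate M a)
    x′≢a′ x′≡a′ = <⇒≢ a<x (sym (toℕ-mate-injective x′≡a′))

  mate-within-edge : ∀ v z → toℕ v ≤ toℕ z → toℕ z ≤ toℕ (mate M v) →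
    toℕ (mate M z) ≤ toℕ (mate M v)
  mate-within-edge v z v≤z z≤v′ with m≤n⇒m<n∨m≡n v≤z
  ... | inj₂ v≡z = ≤-reflexive (cong (toℕ ∘ mate M) (sym (toℕ-injective v≡z)))
  ... | inj₁ v<z with m≤n⇒m<n∨m≡n z≤v′
  ...   | inj₁ z<v′ = <⇒≤ (proj₂ (mate-inside v z v<z z<v′))
  ...   | inj₂ z≡v′ = ≤-trans (≤-reflexive (toℕ-mate-swap (sym z≡v′)))
                              (≤-trans v≤z (≤-reflexive z≡v′))

  InRange : ℕ → ℕ → Fin N → Set
  InRange a b x = a ≤ toℕ x × toℕ x < b

  Closed : ℕ → ℕ → Set
  Closed a b = ∀ x → InRange a b x → InRange a b (mate M x)

  inner-closed : ∀ v → Closed (suc (toℕ v)) (toℕ (mate M v))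
  inner-closed v x (v<x , x<v′) = mate-inside v x v<x x<v′

  rest-closed : ∀ v b → toℕ v < toℕ (mate M v) → Closed (toℕ v) b → Closed (suc (toℕ (mate M v))) b
  rest-closed v b v<v′ closed y (v′<y , y<b) = ≰⇒> y′≰v′ , proj₂ y′-in-range
    where
    y′-in-range : InRange (toℕ v) b (mate M y)
    y′-in-range = closed y (<⇒≤ (<-trans v<v′ v′<y) , y<b)
    y′≰v′ : ¬ toℕ (mate M y) ≤ toℕ (mate M v)
    y′≰v′ y′≤v′ = <⇒≱ v′<y (subst (_≤ toℕ (mate M v)) (toℕ-mate-mate y)
                    (mate-within-edge v (mate M y) (proj₁ y′-in-range) y′≤v′))

module Characterization (k : ℕ) .{{_ : NonZero k}} {N : ℕ} (M : PerfectMatching N)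
                        (plane : IsPlane M) where
  open Coloring k
  open PlaneMatching M plane

  SameColor : Fin N → Set
  SameColor x = color k (toℕ x) ≡ color k (toℕ (mate M x))

  same-color-mate : ∀ x → SameColor x → SameColor (mate M x)
  same-color-mate x same = trans (sym same) (cong (color k) (sym (toℕ-mate-mate x)))

  module _ (k-colored : KColored k M) where

    edge-leaves-block : ∀ x → block k (toℕ x) ≢ block k (toℕ (mate M x))
    edge-leaves-block x same-block = toℕ-mate≢ x (sym (pos-block-injective _ _
      (color-injective-on-parity _ _ (cong (_% 2) same-block) (k-colored x)) same-block))

    valid-block-structure : ValidBlockStructure k M
    valid-block-structure a b same-block a<b (a<a′ , b′<b) with toℕ (mate M a) ≤? toℕ b
    ... | yes a′≤b = edge-leaves-block a (sym (block-between (<⇒≤ a<a′) a′≤b same-block))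
    ... | no a′≰b with toℕ a ≤? toℕ (mate M b)
    ...   | yes a≤b′ = edge-leaves-block b
            (sym (trans (block-between a≤b′ (<⇒≤ b′<b) same-block) same-block))
    ...   | no a≰b′ = no-crossing-from-left a b (≰⇒> a≰b′) a<b (≰⇒> a′≰b)

    no-forbidden-edge : ¬ ∃ (Forbidden k M)
    no-forbidden-edge (s , _ , _ , _ , odd , pos≡) = 1+n≢n (sym (trans same-pos pos≡))
      where
      same-pos : pos k (toℕ s) ≡ pos k (toℕ (mate M s))
      same-pos = color-injective-on-parity _ _
        (sym (odd-gap⇒same-parity (block k (toℕ s)) (block k (toℕ (mate M s))) odd)) (k-colored s)

  ColoredOn : ℕ → ℕ → Set
  ColoredOn a b = ∀ x → InRange a b x → SameColor x

  colored-join : ∀ v b → SameColor v → ColoredOn (suc (toℕ v)) (toℕ (mate M v)) →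
    ColoredOn (suc (toℕ (mate M v))) b → ColoredOn (toℕ v) b
  colored-join v b edge inner rest x (v≤x , x<b) with m≤n⇒m<n∨m≡n v≤x
  ... | inj₂ v≡x = subst SameColor (toℕ-injective v≡x) edge
  ... | inj₁ v<x with <-cmp (toℕ x) (toℕ (mate M v))
  ...   | tri< x<v′ _ _ = inner x (v<x , x<v′)
  ...   | tri≈ _ x≡v′ _ = subst SameColor (sym (toℕ-injective x≡v′)) (same-color-mate v edge)
  ...   | tri> _ _ v′<x = rest x (v′<x , x<b)

  module _ (valid : ValidBlockStructure k M) (no-forbidden : ¬ ∃ (Forbidden k M)) where

    edge-mirror : ∀ v → toℕ v < toℕ (mate M v) → ColoredOn (suc (toℕ v)) (toℕ (mate M v)) →
      SignedCongruent (suc (toℕ v)) (toℕ (mate M v)) → Mirror (toℕ v) (toℕ (mate M v))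
    edge-mirror v _ _ (inj₂ 2k∣) = 2k∣
    edge-mirror v v<v′ inner (inj₁ (m , v′≡)) with k ∣? suc (toℕ v)
    ... | yes k∣ = subst (Mirror (toℕ v)) (sym v′≡) (block-end-mirror (toℕ v) m k∣)
    ... | no k∤ = ⊥-elim (violation m shifted)
      where
      s = toℕ v
      e = toℕ (mate M v)
      shifted : pos k e ≡ suc (pos k s) × block k e ≡ block k s + m * 2
      shifted = subst (λ e → pos k e ≡ suc (pos k s) × block k e ≡ block k s + m * 2)
                      (sym v′≡) (shifted-pos-block s m k∤)
      violation : ∀ j → pos k e ≡ suc (pos k s) × block k e ≡ block k s + j * 2 → ⊥
      violation zero (_ , same-block) =
        valid v (mate M v) (sym (trans same-block (+-identityʳ _))) v<v′
          (v<v′ , subst (_< e) (sym (toℕ-mate-mate v)) v<v′)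
      violation (suc j) (pos≡ , far) =
        no-forbidden (v , v<v′ , leaves , no-bichromatic , odd , pos≡)
        where
        leaves : block k s ≢ block k e
        leaves same-block = m≢1+m+n (block k s) (trans (trans same-block far) (+-suc _ _))
        no-bichromatic : ¬ (∃ λ x → s < toℕ x × toℕ x < e × s < toℕ (mate M x)
                                  × toℕ (mate M x) < e × color k (toℕ x) ≢ color k (toℕ (mate M x)))
        no-bichromatic (x , s<x , x<e , _ , _ , bichromatic) = bichromatic (inner x (s<x , x<e))
        odd : (block k e ∸ block k s ∸ 1) % 2 ≡ 1
        odd = trans (cong (λ b → (b ∸ block k s ∸ 1) % 2) far) (odd-gap (block k s) j)

    -- Induction on the edge {a, q} at the left end of the closed interval [a, b): the intervals
    -- [a + 1, q) and [q + 1, b) are again closed, and shorter.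
    colored-and-congruent : ∀ a b → a ≤ b → b ≤ N → Closed a b → Acc _<_ (b ∸ a) →
      ColoredOn a b × SignedCongruent a b
    colored-and-congruent a b a≤b b≤N closed (acc shorter) with m≤n⇒m<n∨m≡n a≤b
    ... | inj₂ refl = (λ x (a≤x , x<a) → ⊥-elim (<⇒≱ x<a a≤x)) , signed-congruent-refl a
    ... | inj₁ a<b with fromℕ< (<-≤-trans a<b b≤N) | toℕ-fromℕ< (<-≤-trans a<b b≤N)
    ...   | v | refl = colored-join v b (mirror⇒color≡ mirror) (proj₁ inner) (proj₁ rest) ,
                       mirror-signed-congruent a≤b mirror (proj₂ rest)
      where
      v<v′ : toℕ v < toℕ (mate M v)
      v<v′ = ≤∧≢⇒< (proj₁ (closed v (≤-refl , a<b))) (≢-sym (toℕ-mate≢ v))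
      v′<b : toℕ (mate M v) < b
      v′<b = proj₂ (closed v (≤-refl , a<b))
      inner : ColoredOn (suc (toℕ v)) (toℕ (mate M v)) × SignedCongruent (suc (toℕ v)) (toℕ (mate M v))
      inner = colored-and-congruent _ _ v<v′ (<⇒≤ (toℕ<n (mate M v))) (inner-closed v)
                (shorter (shorter-subinterval (n<1+n (toℕ v)) a<b (<⇒≤ v′<b)))
      rest : ColoredOn (suc (toℕ (mate M v))) b × SignedCongruent (suc (toℕ (mate M v))) b
      rest = colored-and-congruent _ _ v′<b b≤N (rest-closed v b v<v′ closed)
               (shorter (shorter-subinterval (<-trans v<v′ (n<1+n _)) v′<b ≤-refl))
      mirror : Mirror (toℕ v) (toℕ (mate M v))
      mirror = edge-mirror v v<v′ (proj₁ inner) (proj₂ inner)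

    k-colored : KColored k M
    k-colored x = proj₁ (colored-and-congruent 0 N z≤n ≤-refl (λ y _ → z≤n , toℕ<n (mate M y))
                                               (<-wellFounded N)) x (z≤n , toℕ<n x)

theorem2 : (k : ℕ) .{{_ : NonZero k}} → 2 ≤ k → (n : ℕ) → 0 < n → k ∣ n →
    (M : PerfectMatching (2 * n)) → IsPlane M →
    KColored k M ⇔ (ValidBlockStructure k M × ¬ (∃ λ s → Forbidden k M s))
theorem2 k _ n _ _ M plane = mk⇔
  (λ colored → valid-block-structure colored , no-forbidden-edge colored)
  (λ (valid , no-forbidden) → k-colored valid no-forbidden)
  where open Characterization k M plane
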